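{- Let $p,p'$ be two-colored partitions. Then (a) $F(\{p\otimes p'\})=F(\{p,p'\})$; (b) $V(\{p\otimes p'\})=V(\{p,p'\})$; (c) $\Sigma(p\otimes p')=\Sigma(p)+\Sigma(p')$; (d) $Y(\{p\otimes p'\})\subseteq Y(\{p,p'\})+\gcd(\Sigma(p),\Sigma(p'))\mathbb Z$ for every $Y\in\{L,K,X\}$.
   Context: A two-colored partition $p$ consists of a lower row $R_L$ and an upper row $R_U$ (disjoint, possibly empty, finite totally ordered sets), a decomposition of $P_p=R_L\cup R_U$ into disjoint nonempty blocks, and a coloring of each point by $\circ$ or $\bullet$. Orientation: the cyclic order on $P_p$ agreeing with the order of $R_L$ on $R_L$, with the reverse order of $R_U$ on $R_U$, with the maximum of $R_U$ succeeding the maximum of $R_L$ and the minimum of $R_L$ succeeding the minimum of $R_U$; intervals $]\alpha,\beta[_p$, $]\alpha,\beta]_p$ for distinct $\alpha,\beta$ refer to this cyclic order. Normalized color: color for lower points, inverse color for upper points. $\sigma_p(S)$: number of normalized-white minus number of normalized-black points of $S$; $\Sigma(p)=\sigma_p(P_p)$. Color distance: $\delta_p(\alpha,\alpha)=\Sigma(p)$; for $\alpha\ne\beta$, $\delta_p(\alpha,\beta)=\sigma_p(]\alpha,\beta[_p)$ if their normalized colors differ and $\sigma_p(]\alpha,\beta]_p)$ if they agree. Blocks $B\neq B'$ cross if there are pairwise distinct $\alpha,\beta\in B$, $\alpha',\beta'\in B'$ appearing in the cyclic order in the order $\alpha,\alpha',\beta,\beta'$. For a set $\mathcal S$ of partitions: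 $F(\mathcal S)=\{|B|: p\in\mathcal S, B$ block of $p\}$; $V(\mathcal S)=\{\sigma_p(B): p\in\mathcal S,B$ block of $p\}$; $\Sigma(\mathcal S)=\{\Sigma(p):p\in\mathcal S\}$; $L(\mathcal S)$ (resp. $K(\mathcal S)$) is the set of $\delta_p(\alpha_1,\alpha_2)$ over $p\in\mathcal S$, blocks $B$ of $p$, $\alpha_1\neq\alpha_2\in B$ with $]\alpha_1,\alpha_2[_p\cap B=\emptyset$ and $\sigma_p(\{\alpha_1,\alpha_2\})\neq0$ (resp. $=0$); $X(\mathcal S)$ is the set of $\delta_p(\alpha_1,\alpha_2)$ over $p\in\mathcal S$, crossing blocks $B_1,B_2$ of $p$, $\alpha_1\in B_1,\alpha_2\in B_2$. The tensor product $p\otimes p'$ is obtained by appending the rows of $p'$ to the right of the respective rows of $p$, keeping blocks and colors. For sets $A\subseteq\mathbb Z$ and $g\in\mathbb Z$, $A+g\mathbb Z=\{a+gz: a\in A,z\in\mathbb Z\}$; $\gcd(0,0)=0$. -}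

module Defs where

open import Data.Nat as ℕ using (ℕ; zero; suc; _<ᵇ_; _≡ᵇ_)
open import Data.Bool using (Bool; true; false; not; _∧_; _∨_; if_then_else_)
open import Data.Integer as ℤ using (ℤ; +_; -_; 0ℤ; 1ℤ; -1ℤ)
open import Data.Integer.GCD using (gcd)
open import Data.Fin as Fin using (Fin; toℕ; splitAt)
open import Data.Fin.Properties using () renaming (_≟_ to _≟F_)
open import Data.Sum using (_⊎_; inj₁; inj₂)
open import Data.Sum.Properties using (≡-dec)
open import Data.Product using (Σ; ∃; ∃-syntax; _×_; _,_)
open import Data.List as List using (List; []; _∷_; _++_; filter; length)
open import Relation.Nullary using (¬_; Dec; yes; no)
open import Relation.Binary.PropositionalEquality using (_≡_; _≢_)
open import Relation.Nullary.Decidable using (⌊_⌋)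
open import Relation.Unary using (Pred)
open import Level using (0ℓ)

-- Lower row R_L = Fin k (ordered as Fin), upper row R_U = Fin l.
-- The decomposition into blocks is given by a labelling of the points
-- with natural numbers: two points lie in the same block iff their
-- labels agree (blocks are the nonempty fibres).
-- Colour: true = ○ (white), false = ● (black).

record Partition : Set where
  field
    k     : ℕ
    l     : ℕ
    label : Fin k ⊎ Fin l → ℕ
    color : Fin k ⊎ Fin l → Bool
open Partition public

Point : Partition → Set
Point p = Fin (k p) ⊎ Fin (l p)

_≟P_ : {p : Partition} → (α β : Point p) → Dec (α ≡ β)
_≟P_ = ≡-dec _≟F_ _≟F_

points : (p : Partition) → List (Point p)
points p = List.map inj₁ (List.allFin (k p)) ++ List.map inj₂ (List.allFin (l p))

-- position in the cyclic order: lower points 0..k-1 in increasing order,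
-- then upper points in decreasing order (max of R_U right after max of R_L,
-- min of R_U last, followed cyclically by min of R_L).
pos : (p : Partition) → Point p → ℕ
pos p (inj₁ i) = toℕ i
pos p (inj₂ j) = k p ℕ.+ (l p ℕ.∸ 1 ℕ.∸ toℕ j)

-- γ ∈ ]α,β[_p  (cyclic open interval), for α ≠ β
inOpen : (p : Partition) → Point p → Point p → Point p → Bool
inOpen p α β γ with pos p α <ᵇ pos p β
... | true  = (pos p α <ᵇ pos p γ) ∧ (pos p γ <ᵇ pos p β)
... | false = (pos p α <ᵇ pos p γ) ∨ (pos p γ <ᵇ pos p β)

inHalfOpen : (p : Partition) → Point p → Point p → Point p → Bool
inHalfOpen p α β γ = inOpen p α β γ ∨ (pos p γ ≡ᵇ pos p β)

ncolor : (p : Partition) → Point p → Bool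
ncolor p (inj₁ i) = color p (inj₁ i)
ncolor p (inj₂ j) = not (color p (inj₂ j))

weight : (p : Partition) → Point p → ℤ
weight p α = if ncolor p α then 1ℤ else -1ℤ

σ : (p : Partition) → (Point p → Bool) → ℤ
σ p S = List.foldr (λ α acc → (if S α then weight p α else 0ℤ) ℤ.+ acc) 0ℤ (points p)

Σp : Partition → ℤ
Σp p = σ p (λ _ → true)

blockOf : (p : Partition) → Point p → Point p → Bool
blockOf p α γ = label p γ ≡ᵇ label p α

card : (p : Partition) → (Point p → Bool) → ℕ
card p S = length (filter (λ α → Relation.Nullary.Decidable.Core.T? (S α)) (points p))
  where import Relation.Nullary.Decidable.Core

δ : (p : Partition) → Point p → Point p → ℤ
δ p α β with _≟P_ {p} α β
... | yes _ = Σp p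
... | no _ with ncolor p α Data.Bool.≟ ncolor p β
...   | no _  = σ p (inOpen p α β)
...   | yes _ = σ p (inHalfOpen p α β)

SameBlock : (p : Partition) → Point p → Point p → Set
SameBlock p α β = label p α ≡ label p β

-- blocks (given by representatives α, α') cross: there are pairwise
-- distinct a, b ∈ B, a', b' ∈ B' in cyclic order a, a', b, b'.
Cross : (p : Partition) → Point p → Point p → Set
Cross p α α' =
  ¬ SameBlock p α α' ×
  ∃[ a ] ∃[ b ] ∃[ a' ] ∃[ b' ]
    (SameBlock p a α × SameBlock p b α × SameBlock p a' α' × SameBlock p b' α' ×
     a ≢ b × a' ≢ b' ×
     inOpen p a b a' ≡ true × inOpen p b a b' ≡ true)

-- The sets F, V, Σ, L, K, X of a single partition (as predicates);
-- for a two-element set {p, p'} one takes the union.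

F₁ : Partition → Pred ℕ 0ℓ
F₁ p n = ∃[ α ] n ≡ card p (blockOf p α)

V₁ : Partition → Pred ℤ 0ℓ
V₁ p z = ∃[ α ] z ≡ σ p (blockOf p α)

Consecutive : (p : Partition) → Point p → Point p → Set
Consecutive p α₁ α₂ =
  SameBlock p α₁ α₂ × α₁ ≢ α₂ ×
  (∀ γ → SameBlock p γ α₁ → inOpen p α₁ α₂ γ ≡ false)

L₁ : Partition → Pred ℤ 0ℓ
L₁ p z = ∃[ α₁ ] ∃[ α₂ ]
  (Consecutive p α₁ α₂ × weight p α₁ ℤ.+ weight p α₂ ≢ 0ℤ × z ≡ δ p α₁ α₂)

K₁ : Partition → Pred ℤ 0ℓ
K₁ p z = ∃[ α₁ ] ∃[ α₂ ]
  (Consecutive p α₁ α₂ × weight p α₁ ℤ.+ weight p α₂ ≡ 0ℤ × z ≡ δ p α₁ α₂)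

X₁ : Partition → Pred ℤ 0ℓ
X₁ p z = ∃[ α₁ ] ∃[ α₂ ] (Cross p α₁ α₂ × z ≡ δ p α₁ α₂)

_∪₂_ : {A : Set} → Pred A 0ℓ → Pred A 0ℓ → Pred A 0ℓ
(P ∪₂ Q) x = P x ⊎ Q x

_+ℤ*_ : Pred ℤ 0ℓ → ℤ → Pred ℤ 0ℓ
(A +ℤ* g) x = ∃[ a ] ∃[ z ] (A a × x ≡ a ℤ.+ g ℤ.* z)

-- Tensor product: rows of p' appended to the right of the rows of p.
-- Labels: block b of p becomes 2b, block b of p' becomes 2b+1.

_⊗_ : Partition → Partition → Partition
p ⊗ p' = record
  { k = k p ℕ.+ k p'
  ; l = l p ℕ.+ l p'
  ; label = lab
  ; color = col
  }
  where
  lab : Fin (k p ℕ.+ k p') ⊎ Fin (l p ℕ.+ l p') → ℕ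
  lab (inj₁ i) with splitAt (k p) i
  ... | inj₁ a = 2 ℕ.* label p (inj₁ a)
  ... | inj₂ b = suc (2 ℕ.* label p' (inj₁ b))
  lab (inj₂ j) with splitAt (l p) j
  ... | inj₁ a = 2 ℕ.* label p (inj₂ a)
  ... | inj₂ b = suc (2 ℕ.* label p' (inj₂ b))
  col : Fin (k p ℕ.+ k p') ⊎ Fin (l p ℕ.+ l p') → Bool
  col (inj₁ i) with splitAt (k p) i
  ... | inj₁ a = color p (inj₁ a)
  ... | inj₂ b = color p' (inj₁ b)
  col (inj₂ j) with splitAt (l p) j
  ... | inj₁ a = color p (inj₂ a)
  ... | inj₂ b = color p' (inj₂ b)

-- In p ⊗ p' the points of p keep their cyclic order, the points of p' fill the
-- window of positions [k p, k p + k p' + l p') in their own order, and no block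
-- meets both factors.  So block sizes and block weights are those of p and p',
-- and Σ is additive.  An interval of p ⊗ p' with both ends in p contains either
-- the whole window or none of it, so its σ is that of the corresponding interval
-- of p plus 0 or Σ(p'); an interval with both ends in p' likewise contains all of
-- p or none of it.  Hence colour distances only move by multiples of
-- gcd(Σ(p), Σ(p')).  Finally no block of p crosses a block of p': two points of
-- p' would have to lie on both arcs between two points of p, but the window lies
-- on only one of them.
module Submission where

open import Defs

open import Algebra.Bundles using (CommutativeMonoid)
open import Algebra.Structures using (IsCommutativeMonoid)
open import Data.Bool using (Bool; true; false; not; _∧_; _∨_; if_then_else_)
open import Data.Bool.Properties using (T?; ∨-identityʳ; ∧-zeroʳ) renaming (_≟_ to _≟𝔹_)
open import Data.Empty using (⊥; ⊥-elim)
open import Data.Fin as Fin using (Fin; toℕ; _↑ˡ_; _↑ʳ_; splitAt)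
open import Data.Fin.Properties
  using (toℕ<n; toℕ-injective; toℕ-↑ˡ; toℕ-↑ʳ; splitAt-↑ˡ; splitAt-↑ʳ; join-splitAt)
open import Data.Integer as ℤ using (ℤ; 0ℤ; 1ℤ; -1ℤ; _+_)
import Data.Integer.Properties as ℤ
open import Data.Integer.Divisibility.Signed using (_∣_; divides; ∣ᵤ⇒∣)
open import Data.Integer.GCD using (gcd; gcd[i,j]∣i; gcd[i,j]∣j)
open import Data.List as List using (List; []; _∷_; _++_)
import Data.List.Properties as ListP
open import Data.List.Relation.Binary.Permutation.Propositional
  using (_↭_; ↭⇒↭ₛ; module PermutationReasoning)
import Data.List.Relation.Binary.Permutation.Propositional.Properties as ↭
open import Data.List.Relation.Binary.Permutation.Setoid.Properties using (foldr-commMonoid)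
open import Data.Nat as ℕ using (ℕ; zero; suc; _<ᵇ_; _≡ᵇ_; _<_; _≤_; _∸_; s≤s)
open import Data.Nat.Properties as ℕ
  using (_<?_; <-cmp; ≤⇒≯; <⇒≢; <⇒≱; ≮⇒≥; <-≤-trans; ≤-trans; m≤m+n; +-monoʳ-<; +-monoʳ-≤; m∸n≤m)
open import Data.Nat.Solver using (module +-*-Solver)
open import Data.Product using (∃-syntax; _×_; _,_)
open import Data.Sum using (_⊎_; inj₁; inj₂)
open import Function using (_∘_; id; case_of_)
open import Function.Bundles using (_⇔_; mk⇔; Equivalence)
open import Level using (0ℓ)
open import Relation.Binary.Definitions using (tri<; tri≈; tri>)
open import Relation.Binary.PropositionalEquality
open import Relation.Nullary using (¬_; yes; no; does)
open import Relation.Nullary.Decidable using (does-≡; dec-true; dec-false; map′)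
open import Relation.Unary using (Pred)

open +-*-Solver using (solve; _:+_; _:=_)

-- Comparisons and the cyclic order on ℕ

<ᵇ-cong : ∀ {a b c d} → (a < b → c < d) → (c < d → a < b) → (a <ᵇ b) ≡ (c <ᵇ d)
<ᵇ-cong {a} {b} {c} {d} to from = does-≡ (a <? b) (map′ from to (c <? d))

<ᵇ-true : ∀ {a b} → a < b → (a <ᵇ b) ≡ true
<ᵇ-true {a} {b} = dec-true (a <? b)

<ᵇ-false : ∀ {a b} → b ≤ a → (a <ᵇ b) ≡ false
<ᵇ-false {a} {b} b≤a = dec-false (a <? b) (≤⇒≯ b≤a)

≡ᵇ-cong : ∀ {a b c d} → (a ≡ b → c ≡ d) → (c ≡ d → a ≡ b) → (a ≡ᵇ b) ≡ (c ≡ᵇ d)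
≡ᵇ-cong {a} {b} {c} {d} to from = does-≡ (a ℕ.≟ b) (map′ from to (c ℕ.≟ d))

≡ᵇ-false : ∀ {a b} → a ≢ b → (a ≡ᵇ b) ≡ false
≡ᵇ-false {a} {b} = dec-false (a ℕ.≟ b)

∧-not⇒∨-not-false : ∀ a b → a ∧ not b ≡ true → b ∨ not a ≡ false
∧-not⇒∨-not-false true false _ = refl

not-<ᵇ⇒≥ : ∀ {x y} → not (x <ᵇ y) ≡ true → y ≤ x
not-<ᵇ⇒≥ {x} {y} x≮ᵇy = ≮⇒≥ λ x<y → case subst (λ b → not b ≡ true) (<ᵇ-true x<y) x≮ᵇy of λ ()

StrictlyIncreasing : (ℕ → ℕ) → Set
StrictlyIncreasing f = ∀ {x y} → x < y → f x < f y

module _ {f : ℕ → ℕ} (f-< : StrictlyIncreasing f) where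

  strictlyIncreasing-reflects-< : ∀ {x y} → f x < f y → x < y
  strictlyIncreasing-reflects-< {x} {y} fx<fy with <-cmp x y
  ... | tri< x<y _ _ = x<y
  ... | tri≈ _ refl _ = ⊥-elim (<⇒≢ fx<fy refl)
  ... | tri> _ _ y<x = ⊥-elim (<⇒≱ fx<fy (ℕ.<⇒≤ (f-< y<x)))

  strictlyIncreasing-injective : ∀ {x y} → f x ≡ f y → x ≡ y
  strictlyIncreasing-injective {x} {y} fx≡fy with <-cmp x y
  ... | tri< x<y _ _ = ⊥-elim (<⇒≢ (f-< x<y) fx≡fy)
  ... | tri≈ _ x≡y _ = x≡y
  ... | tri> _ _ y<x = ⊥-elim (<⇒≢ (f-< y<x) (sym fx≡fy))

  <ᵇ-strictlyIncreasing : ∀ x y → (f x <ᵇ f y) ≡ (x <ᵇ y)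
  <ᵇ-strictlyIncreasing x y = <ᵇ-cong strictlyIncreasing-reflects-< f-<

  ≡ᵇ-strictlyIncreasing : ∀ x y → (f x ≡ᵇ f y) ≡ (x ≡ᵇ y)
  ≡ᵇ-strictlyIncreasing x y = ≡ᵇ-cong strictlyIncreasing-injective (cong f)

between : ℕ → ℕ → ℕ → Bool
between x y z = if x <ᵇ y then (x <ᵇ z) ∧ (z <ᵇ y) else (x <ᵇ z) ∨ (z <ᵇ y)

between-strictlyIncreasing : ∀ {f} → StrictlyIncreasing f →
  ∀ x y z → between (f x) (f y) (f z) ≡ between x y z
between-strictlyIncreasing f-< x y z
  rewrite <ᵇ-strictlyIncreasing f-< x y | <ᵇ-strictlyIncreasing f-< x z | <ᵇ-strictlyIncreasing f-< z y = refl

module Window (K N : ℕ) where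

  Inside : ℕ → Set
  Inside u = K ≤ u × u < K ℕ.+ N

  Outside : ℕ → Set
  Outside x = x < K ⊎ K ℕ.+ N ≤ x

  skipWindow : ℕ → ℕ
  skipWindow x with x <? K
  ... | yes _ = x
  ... | no _ = N ℕ.+ x

  skipWindow-below : ∀ {x} → x < K → skipWindow x ≡ x
  skipWindow-below {x} x<K with x <? K
  ... | yes _ = refl
  ... | no x≮K = ⊥-elim (x≮K x<K)

  skipWindow-above : ∀ {x} → K ≤ x → skipWindow x ≡ N ℕ.+ x
  skipWindow-above {x} K≤x with x <? K
  ... | yes x<K = ⊥-elim (≤⇒≯ K≤x x<K)
  ... | no _ = refl

  skipWindow-outside : ∀ x → Outside (skipWindow x)
  skipWindow-outside x with x <? K
  ... | yes x<K = inj₁ x<K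
  ... | no x≮K = inj₂ (subst (_≤ N ℕ.+ x) (ℕ.+-comm N K) (+-monoʳ-≤ N (≮⇒≥ x≮K)))

  skipWindow-< : StrictlyIncreasing skipWindow
  skipWindow-< {x} {y} x<y with x <? K | y <? K
  ... | yes _ | yes _ = x<y
  ... | yes x<K | no y≮K = <-≤-trans x<K (≤-trans (≮⇒≥ y≮K) (ℕ.m≤n+m y N))
  ... | no x≮K | yes y<K = ⊥-elim (x≮K (ℕ.<-trans x<y y<K))
  ... | no _ | no _ = +-monoʳ-< N x<y

  outside-<ᵇ-inside : ∀ {x u} → Outside x → Inside u → (x <ᵇ u) ≡ (x <ᵇ K)
  outside-<ᵇ-inside (inj₁ x<K) (K≤u , _) = trans (<ᵇ-true (<-≤-trans x<K K≤u)) (sym (<ᵇ-true x<K))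
  outside-<ᵇ-inside (inj₂ K+N≤x) (_ , u<K+N) =
    trans (<ᵇ-false (ℕ.<⇒≤ (<-≤-trans u<K+N K+N≤x))) (sym (<ᵇ-false (≤-trans (m≤m+n K N) K+N≤x)))

  inside-<ᵇ-outside : ∀ {u x} → Inside u → Outside x → (u <ᵇ x) ≡ not (x <ᵇ K)
  inside-<ᵇ-outside (K≤u , _) (inj₁ x<K) =
    trans (<ᵇ-false (ℕ.<⇒≤ (<-≤-trans x<K K≤u))) (cong not (sym (<ᵇ-true x<K)))
  inside-<ᵇ-outside (_ , u<K+N) (inj₂ K+N≤x) =
    trans (<ᵇ-true (<-≤-trans u<K+N K+N≤x)) (cong not (sym (<ᵇ-false (≤-trans (m≤m+n K N) K+N≤x))))

  -- the cyclic arc from x to y, both outside the window, runs through the window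
  crossesWindow : ℕ → ℕ → Bool
  crossesWindow x y = if x <ᵇ y then (x <ᵇ K) ∧ not (y <ᵇ K) else (x <ᵇ K) ∨ not (y <ᵇ K)

  between-outside-outside-inside : ∀ {x y u} → Outside x → Outside y → Inside u →
    between x y u ≡ crossesWindow x y
  between-outside-outside-inside {x} {y} x-out y-out u-in
    rewrite outside-<ᵇ-inside x-out u-in | inside-<ᵇ-outside u-in y-out = refl

  between-inside-inside-outside : ∀ {u v x} → Inside u → Inside v → Outside x →
    between u v x ≡ not (u <ᵇ v)
  between-inside-inside-outside {u} {v} {x} u-in v-in x-out
    rewrite inside-<ᵇ-outside u-in x-out | outside-<ᵇ-inside x-out v-in
    with u <ᵇ v | x <ᵇ K
  ... | true  | true  = refl
  ... | true  | false = refl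
  ... | false | true  = refl
  ... | false | false = refl

  crossesWindow-asym : ∀ {x y} → x ≢ y → crossesWindow x y ≡ true → crossesWindow y x ≡ true → ⊥
  crossesWindow-asym {x} {y} x≢y xy yx with <-cmp x y
  ... | tri≈ _ x≡y _ = x≢y x≡y
  ... | tri< x<y _ _ rewrite <ᵇ-true x<y | <ᵇ-false (ℕ.<⇒≤ x<y) =
    case trans (sym (∧-not⇒∨-not-false (x <ᵇ K) (y <ᵇ K) xy)) yx of λ ()
  ... | tri> _ _ y<x rewrite <ᵇ-true y<x | <ᵇ-false (ℕ.<⇒≤ y<x) =
    case trans (sym (∧-not⇒∨-not-false (y <ᵇ K) (x <ᵇ K) yx)) xy of λ ()

module FoldSum {A : Set} {_∙_ : A → A → A} {ε : A} (isCM : IsCommutativeMonoid _≡_ _∙_ ε) where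

  open IsCommutativeMonoid isCM using (assoc; identityˡ)

  sumOver : {X : Set} → (X → A) → List X → A
  sumOver f = List.foldr (λ x acc → f x ∙ acc) ε

  sumOver-cong : ∀ {X} {f g : X → A} → (∀ x → f x ≡ g x) → ∀ xs → sumOver f xs ≡ sumOver g xs
  sumOver-cong f≗g = ListP.foldr-cong (λ x acc → cong (_∙ acc) (f≗g x)) refl

  sumOver-ε : ∀ {X} (xs : List X) → sumOver (λ _ → ε) xs ≡ ε
  sumOver-ε []       = refl
  sumOver-ε (_ ∷ xs) = trans (identityˡ _) (sumOver-ε xs)

  sumOver-++ : ∀ {X} (f : X → A) xs ys → sumOver f (xs ++ ys) ≡ sumOver f xs ∙ sumOver f ys
  sumOver-++ f []       ys = sym (identityˡ _)
  sumOver-++ f (x ∷ xs) ys = trans (cong (f x ∙_) (sumOver-++ f xs ys)) (sym (assoc _ _ _))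

  sumOver-map : ∀ {X Y} (f : Y → A) (g : X → Y) xs → sumOver f (List.map g xs) ≡ sumOver (f ∘ g) xs
  sumOver-map f g = ListP.foldr-map _ g ε

  sumOver-↭ : ∀ {X} (f : X → A) {xs ys} → xs ↭ ys → sumOver f xs ≡ sumOver f ys
  sumOver-↭ f {xs} {ys} xs↭ys = begin
    sumOver f xs                       ≡⟨ sumOver-map id f xs ⟨
    List.foldr _∙_ ε (List.map f xs)   ≡⟨ foldr-commMonoid (setoid A) isCM (↭⇒↭ₛ (↭.map⁺ f xs↭ys)) ⟩
    List.foldr _∙_ ε (List.map f ys)   ≡⟨ sumOver-map id f ys ⟩
    sumOver f ys                       ∎
    where open ≡-Reasoning

tabulate-+ : ∀ {A : Set} m {n} (f : Fin (m ℕ.+ n) → A) →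
  List.tabulate f ≡ List.tabulate (f ∘ (_↑ˡ n)) ++ List.tabulate (f ∘ (m ↑ʳ_))
tabulate-+ zero    f = refl
tabulate-+ (suc m) f = cong (f Fin.zero ∷_) (tabulate-+ m (f ∘ Fin.suc))

-- Positions, intervals and sums in a partition

reverse-injective : ∀ {l s t} → s < l → t < l → l ∸ 1 ∸ s ≡ l ∸ 1 ∸ t → s ≡ t
reverse-injective {suc m} (s≤s s≤m) (s≤s t≤m) eq =
  trans (sym (ℕ.m∸[m∸n]≡n s≤m)) (trans (cong (m ∸_) eq) (ℕ.m∸[m∸n]≡n t≤m))

reverse-< : ∀ {l t} → t < l → l ∸ 1 ∸ t < l
reverse-< {suc m} {t} _ = s≤s (m∸n≤m m t)

reverse-↑ˡ : ∀ {l l' t} → t < l → (l ℕ.+ l') ∸ 1 ∸ t ≡ (l ∸ 1 ∸ t) ℕ.+ l'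
reverse-↑ˡ {suc m} {l'} (s≤s t≤m) = ℕ.+-∸-comm l' t≤m

reverse-↑ʳ : ∀ l l' t → (l ℕ.+ l') ∸ 1 ∸ (l ℕ.+ t) ≡ l' ∸ 1 ∸ t
reverse-↑ʳ l l' t = begin
  (l ℕ.+ l') ∸ 1 ∸ (l ℕ.+ t)    ≡⟨ ℕ.∸-+-assoc (l ℕ.+ l') 1 (l ℕ.+ t) ⟩
  (l ℕ.+ l') ∸ suc (l ℕ.+ t)    ≡⟨ cong ((l ℕ.+ l') ∸_) (ℕ.+-suc l t) ⟨
  (l ℕ.+ l') ∸ (l ℕ.+ suc t)    ≡⟨ ℕ.[m+n]∸[m+o]≡n∸o l l' (suc t) ⟩
  l' ∸ suc t                    ≡⟨ ℕ.∸-+-assoc l' 1 t ⟨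
  l' ∸ 1 ∸ t                    ∎
  where open ≡-Reasoning

pos-< : ∀ q (α : Point q) → pos q α < k q ℕ.+ l q
pos-< q (inj₁ i) = <-≤-trans (toℕ<n i) (m≤m+n (k q) (l q))
pos-< q (inj₂ j) = +-monoʳ-< (k q) (reverse-< (toℕ<n j))

pos-injective : ∀ q {α β : Point q} → pos q α ≡ pos q β → α ≡ β
pos-injective q {inj₁ i} {inj₁ j} eq = cong inj₁ (toℕ-injective eq)
pos-injective q {inj₁ i} {inj₂ j} eq = ⊥-elim (<⇒≢ (<-≤-trans (toℕ<n i) (m≤m+n (k q) _)) eq)
pos-injective q {inj₂ i} {inj₁ j} eq = ⊥-elim (<⇒≢ (<-≤-trans (toℕ<n j) (m≤m+n (k q) _)) (sym eq))
pos-injective q {inj₂ i} {inj₂ j} eq =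
  cong inj₂ (toℕ-injective (reverse-injective (toℕ<n i) (toℕ<n j) (ℕ.+-cancelˡ-≡ (k q) _ _ eq)))

inOpen≡between : ∀ q (α β γ : Point q) → inOpen q α β γ ≡ between (pos q α) (pos q β) (pos q γ)
inOpen≡between q α β γ with pos q α <ᵇ pos q β
... | true  = refl
... | false = refl

-- the interval in δ q α β: ]α,β] if the normalized colours agree, ]α,β[ otherwise
arc : (q : Partition) → Point q → Point q → Point q → Bool
arc q α β γ = inOpen q α β γ ∨ (does (ncolor q α ≟𝔹 ncolor q β) ∧ (pos q γ ≡ᵇ pos q β))

arc≡inOpen : ∀ q {α β γ : Point q} → γ ≢ β → arc q α β γ ≡ inOpen q α β γ
arc≡inOpen q {α} {β} {γ} γ≢β = begin
  arc q α β γ                             ≡⟨ cong (λ b → inOpen q α β γ ∨ (same ∧ b)) (≡ᵇ-false (γ≢β ∘ pos-injective q)) ⟩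
  inOpen q α β γ ∨ (same ∧ false)         ≡⟨ cong (inOpen q α β γ ∨_) (∧-zeroʳ same) ⟩
  inOpen q α β γ ∨ false                  ≡⟨ ∨-identityʳ _ ⟩
  inOpen q α β γ                          ∎
  where
  open ≡-Reasoning
  same : Bool
  same = does (ncolor q α ≟𝔹 ncolor q β)

map-points : ∀ {A : Set} q (f : Point q → A) →
  List.map f (points q) ≡ List.tabulate (f ∘ inj₁) ++ List.tabulate (f ∘ inj₂)
map-points q f = begin
  List.map f (points q)
    ≡⟨ ListP.map-++ f (List.map inj₁ (List.allFin (k q))) _ ⟩
  List.map f (List.map inj₁ (List.allFin _)) ++ List.map f (List.map inj₂ (List.allFin _))
    ≡⟨ cong₂ _++_ (trans (cong (List.map f) (ListP.map-tabulate id inj₁)) (ListP.map-tabulate inj₁ f))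
                  (trans (cong (List.map f) (ListP.map-tabulate id inj₂)) (ListP.map-tabulate inj₂ f)) ⟩
  List.tabulate (f ∘ inj₁) ++ List.tabulate (f ∘ inj₂)                            ∎
  where open ≡-Reasoning

module ℤΣ = FoldSum ℤ.+-0-isCommutativeMonoid
module ℕΣ = FoldSum ℕ.+-0-isCommutativeMonoid

σ-cong : ∀ q {S S' : Point q → Bool} → (∀ γ → S γ ≡ S' γ) → σ q S ≡ σ q S'
σ-cong q S≗S' = ℤΣ.sumOver-cong (λ γ → cong (if_then weight q γ else 0ℤ) (S≗S' γ)) (points q)

σ-const : ∀ q C → σ q (λ _ → C) ≡ (if C then Σp q else 0ℤ)
σ-const q true  = refl
σ-const q false = ℤΣ.sumOver-ε (points q)

δ-distinct : ∀ q {α β : Point q} → α ≢ β → δ q α β ≡ σ q (arc q α β)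
δ-distinct q {α} {β} α≢β with _≟P_ {q} α β
... | yes α≡β = ⊥-elim (α≢β α≡β)
... | no _ with ncolor q α ≟𝔹 ncolor q β
...   | yes _ = refl
...   | no _  = σ-cong q λ γ → sym (∨-identityʳ (inOpen q α β γ))

indicator : {X : Set} → (X → Bool) → X → ℕ
indicator S x = if S x then 1 else 0

card≡sumOver : ∀ q (S : Point q → Bool) → card q S ≡ ℕΣ.sumOver (indicator S) (points q)
card≡sumOver q S = go (points q)
  where
  go : ∀ xs → List.length (List.filter (λ γ → T? (S γ)) xs) ≡ ℕΣ.sumOver (indicator S) xs
  go [] = refl
  go (x ∷ xs) with S x
  ... | true  = cong suc (go xs)
  ... | false = go xs

card-cong : ∀ q {S S' : Point q → Bool} → (∀ γ → S γ ≡ S' γ) → card q S ≡ card q S'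
card-cong q {S} {S'} S≗S' = begin
  card q S                              ≡⟨ card≡sumOver q S ⟩
  ℕΣ.sumOver (indicator S) (points q)   ≡⟨ ℕΣ.sumOver-cong (λ γ → cong (if_then 1 else 0) (S≗S' γ)) (points q) ⟩
  ℕΣ.sumOver (indicator S') (points q)  ≡⟨ card≡sumOver q S' ⟨
  card q S'                             ∎
  where open ≡-Reasoning

card-empty : ∀ q → card q (λ _ → false) ≡ 0
card-empty q = trans (card≡sumOver q _) (ℕΣ.sumOver-ε (points q))

+ℤ*-shift : ∀ {A : Pred ℤ 0ℓ} {g a d} → A a → g ∣ d → (A +ℤ* g) (a + d)
+ℤ*-shift {g = g} {a} Aa (divides q d≡q*g) = a , q , Aa , cong (a +_) (trans d≡q*g (ℤ.*-comm q g))

∣-select : ∀ {g s} C → g ∣ s → g ∣ (if C then s else 0ℤ)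
∣-select true  g∣s = g∣s
∣-select {g} false _ = divides 0ℤ (sym (ℤ.*-zeroˡ g))

-- L₁ and K₁ are the cases R = (_≢ 0ℤ) and R = (_≡ 0ℤ)
ConsecutiveDistances : Partition → (ℤ → Set) → Pred ℤ 0ℓ
ConsecutiveDistances q R z =
  ∃[ α₁ ] ∃[ α₂ ] (Consecutive q α₁ α₂ × R (weight q α₁ + weight q α₂) × z ≡ δ q α₁ α₂)

record Embedding (q r : Partition) : Set where
  field
    map           : Point q → Point r
    shift         : ℕ → ℕ
    shift-<       : StrictlyIncreasing shift
    pos-map       : ∀ α → pos r (map α) ≡ shift (pos q α)
    ncolor-map    : ∀ α → ncolor r (map α) ≡ ncolor q α
    sameBlock-map : ∀ {α β} → SameBlock r (map α) (map β) ⇔ SameBlock q α β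
    block-closed  : ∀ {x} α → SameBlock r x (map α) → ∃[ u ] x ≡ map u

sameBlock-relabel : ∀ {q r} {f : Point q → Point r} {g : ℕ → ℕ} → (∀ {m n} → g m ≡ g n → m ≡ n) →
  (∀ α → label r (f α) ≡ g (label q α)) → ∀ {α β} → SameBlock r (f α) (f β) ⇔ SameBlock q α β
sameBlock-relabel {g = g} g-injective label-f {α} {β} = mk⇔
  (λ fα∼fβ → g-injective (trans (sym (label-f α)) (trans fα∼fβ (label-f β))))
  (λ α∼β → trans (label-f α) (trans (cong g α∼β) (sym (label-f β))))

module EmbeddingProperties {q r : Partition} (e : Embedding q r) where

  open Embedding e

  map-injective : ∀ {α β} → map α ≡ map β → α ≡ β
  map-injective {α} {β} eq = pos-injective q (strictlyIncreasing-injective shift-< (begin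
    shift (pos q α)  ≡⟨ pos-map α ⟨
    pos r (map α)    ≡⟨ cong (pos r) eq ⟩
    pos r (map β)    ≡⟨ pos-map β ⟩
    shift (pos q β)  ∎))
    where open ≡-Reasoning

  weight-map : ∀ α → weight r (map α) ≡ weight q α
  weight-map α = cong (if_then 1ℤ else -1ℤ) (ncolor-map α)

  inOpen-map : ∀ a b c → inOpen r (map a) (map b) (map c) ≡ inOpen q a b c
  inOpen-map a b c rewrite inOpen≡between r (map a) (map b) (map c) | pos-map a | pos-map b | pos-map c =
    trans (between-strictlyIncreasing shift-< _ _ _) (sym (inOpen≡between q a b c))

  arc-map : ∀ a b c → arc r (map a) (map b) (map c) ≡ arc q a b c
  arc-map a b c = cong₂ _∨_ (inOpen-map a b c) (cong₂ _∧_
    (cong₂ (λ x y → does (x ≟𝔹 y)) (ncolor-map a) (ncolor-map b))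
    (trans (cong₂ _≡ᵇ_ (pos-map c) (pos-map b)) (≡ᵇ-strictlyIncreasing shift-< _ _)))

  blockOf-map : ∀ α γ → blockOf r (map α) (map γ) ≡ blockOf q α γ
  blockOf-map α γ = ≡ᵇ-cong (Equivalence.to sameBlock-map) (Equivalence.from sameBlock-map)

  block-preimage : ∀ {x α} → SameBlock r x (map α) → ∃[ u ] x ≡ map u × SameBlock q u α
  block-preimage {α = α} x∼α with block-closed α x∼α
  ... | u , refl = u , refl , Equivalence.to sameBlock-map x∼α

  consecutive-map : ∀ {a b} → Consecutive r (map a) (map b) → Consecutive q a b
  consecutive-map {a} {b} (a∼b , a≢b , empty) =
    Equivalence.to sameBlock-map a∼b , a≢b ∘ cong map ,
    λ γ γ∼a → trans (sym (inOpen-map a b γ)) (empty (map γ) (Equivalence.from sameBlock-map γ∼a))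

  cross-map : ∀ {α₁ α₂} → Cross r (map α₁) (map α₂) → Cross q α₁ α₂
  cross-map (α₁≁α₂ , a , b , a' , b' , a∼ , b∼ , a'∼ , b'∼ , a≢b , a'≢b' , a'∈]a,b[ , b'∈]b,a[)
    with block-preimage a∼ | block-preimage b∼ | block-preimage a'∼ | block-preimage b'∼
  ... | u , refl , u∼ | v , refl , v∼ | u' , refl , u'∼ | v' , refl , v'∼ =
    α₁≁α₂ ∘ Equivalence.from sameBlock-map , u , v , u' , v' , u∼ , v∼ , u'∼ , v'∼ ,
    a≢b ∘ cong map , a'≢b' ∘ cong map ,
    trans (sym (inOpen-map u v u')) a'∈]a,b[ , trans (sym (inOpen-map v u v')) b'∈]b,a[

-- The tensor product

module Tensor (p p' : Partition) where

  K : ℕ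
  K = k p

  N : ℕ
  N = k p' ℕ.+ l p'

  open Window K N

  ι : Point p → Point (p ⊗ p')
  ι (inj₁ i) = inj₁ (i ↑ˡ k p')
  ι (inj₂ j) = inj₂ (j ↑ˡ l p')

  ι' : Point p' → Point (p ⊗ p')
  ι' (inj₁ i) = inj₁ (k p ↑ʳ i)
  ι' (inj₂ j) = inj₂ (l p ↑ʳ j)

  data Origin : Point (p ⊗ p') → Set where
    left  : ∀ α → Origin (ι α)
    right : ∀ β → Origin (ι' β)

  origin : ∀ x → Origin x
  origin (inj₁ i) with splitAt (k p) i | join-splitAt (k p) (k p') i
  ... | inj₁ a | refl = left (inj₁ a)
  ... | inj₂ b | refl = right (inj₁ b)
  origin (inj₂ j) with splitAt (l p) j | join-splitAt (l p) (l p') j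
  ... | inj₁ a | refl = left (inj₂ a)
  ... | inj₂ b | refl = right (inj₂ b)

  points-⊗ : points (p ⊗ p') ↭ List.map ι (points p) ++ List.map ι' (points p')
  points-⊗ = begin
    points (p ⊗ p')                                   ≡⟨ ListP.map-id _ ⟨
    List.map id (points (p ⊗ p'))                     ≡⟨ map-points (p ⊗ p') id ⟩
    List.tabulate inj₁ ++ List.tabulate inj₂          ≡⟨ cong₂ _++_ (tabulate-+ (k p) inj₁) (tabulate-+ (l p) inj₂) ⟩
    (lower-p ++ lower-p') ++ (upper-p ++ upper-p')    ↭⟨ interchange lower-p lower-p' upper-p upper-p' ⟩
    (lower-p ++ upper-p) ++ (lower-p' ++ upper-p')    ≡⟨ cong₂ _++_ (map-points p ι) (map-points p' ι') ⟨
    List.map ι (points p) ++ List.map ι' (points p')  ∎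
    where
    open PermutationReasoning
    open import Algebra.Properties.CommutativeSemigroup
      (CommutativeMonoid.commutativeSemigroup (↭.++-commutativeMonoid {A = Point (p ⊗ p')})) using (interchange)
    lower-p upper-p lower-p' upper-p' : List (Point (p ⊗ p'))
    lower-p  = List.tabulate (ι ∘ inj₁)
    upper-p  = List.tabulate (ι ∘ inj₂)
    lower-p' = List.tabulate (ι' ∘ inj₁)
    upper-p' = List.tabulate (ι' ∘ inj₂)

  label-ι : ∀ α → label (p ⊗ p') (ι α) ≡ 2 ℕ.* label p α
  label-ι (inj₁ i) rewrite splitAt-↑ˡ (k p) i (k p') = refl
  label-ι (inj₂ j) rewrite splitAt-↑ˡ (l p) j (l p') = refl

  label-ι' : ∀ β → label (p ⊗ p') (ι' β) ≡ suc (2 ℕ.* label p' β)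
  label-ι' (inj₁ i) rewrite splitAt-↑ʳ (k p) (k p') i = refl
  label-ι' (inj₂ j) rewrite splitAt-↑ʳ (l p) (l p') j = refl

  ncolor-ι : ∀ α → ncolor (p ⊗ p') (ι α) ≡ ncolor p α
  ncolor-ι (inj₁ i) rewrite splitAt-↑ˡ (k p) i (k p') = refl
  ncolor-ι (inj₂ j) rewrite splitAt-↑ˡ (l p) j (l p') = refl

  ncolor-ι' : ∀ β → ncolor (p ⊗ p') (ι' β) ≡ ncolor p' β
  ncolor-ι' (inj₁ i) rewrite splitAt-↑ʳ (k p) (k p') i = refl
  ncolor-ι' (inj₂ j) rewrite splitAt-↑ʳ (l p) (l p') j = refl

  pos-ι : ∀ α → pos (p ⊗ p') (ι α) ≡ skipWindow (pos p α)
  pos-ι (inj₁ i) = trans (toℕ-↑ˡ i (k p')) (sym (skipWindow-below (toℕ<n i)))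
  pos-ι (inj₂ j) rewrite toℕ-↑ˡ j (l p') = begin
    (k p ℕ.+ k p') ℕ.+ ((l p ℕ.+ l p') ∸ 1 ∸ toℕ j)
      ≡⟨ cong ((k p ℕ.+ k p') ℕ.+_) (reverse-↑ˡ (toℕ<n j)) ⟩
    (k p ℕ.+ k p') ℕ.+ ((l p ∸ 1 ∸ toℕ j) ℕ.+ l p')
      ≡⟨ solve 4 (λ a b c d → (a :+ b) :+ (d :+ c) := (b :+ c) :+ (a :+ d)) refl
               (k p) (k p') (l p') (l p ∸ 1 ∸ toℕ j) ⟩
    N ℕ.+ pos p (inj₂ j)
      ≡⟨ skipWindow-above (m≤m+n (k p) _) ⟨
    skipWindow (pos p (inj₂ j)) ∎
    where open ≡-Reasoning

  pos-ι' : ∀ β → pos (p ⊗ p') (ι' β) ≡ K ℕ.+ pos p' β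
  pos-ι' (inj₁ i) = toℕ-↑ʳ (k p) i
  pos-ι' (inj₂ j) rewrite toℕ-↑ʳ (l p) j = begin
    (k p ℕ.+ k p') ℕ.+ ((l p ℕ.+ l p') ∸ 1 ∸ (l p ℕ.+ toℕ j))
      ≡⟨ cong ((k p ℕ.+ k p') ℕ.+_) (reverse-↑ʳ (l p) (l p') (toℕ j)) ⟩
    (k p ℕ.+ k p') ℕ.+ (l p' ∸ 1 ∸ toℕ j)
      ≡⟨ ℕ.+-assoc (k p) (k p') _ ⟩
    K ℕ.+ pos p' (inj₂ j) ∎
    where open ≡-Reasoning

  ι≁ι' : ∀ α β → ¬ SameBlock (p ⊗ p') (ι α) (ι' β)
  ι≁ι' α β α∼β = ℕ.even≢odd (label p α) (label p' β) (begin
    2 ℕ.* label p α        ≡⟨ label-ι α ⟨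
    label (p ⊗ p') (ι α)   ≡⟨ α∼β ⟩
    label (p ⊗ p') (ι' β)  ≡⟨ label-ι' β ⟩
    suc (2 ℕ.* label p' β) ∎)
    where open ≡-Reasoning

  ιᴱ : Embedding p (p ⊗ p')
  ιᴱ = record
    { map           = ι
    ; shift         = skipWindow
    ; shift-<       = skipWindow-<
    ; pos-map       = pos-ι
    ; ncolor-map    = ncolor-ι
    ; sameBlock-map = sameBlock-relabel {p} {p ⊗ p'} {ι} (ℕ.*-cancelˡ-≡ _ _ 2) label-ι
    ; block-closed  = closed
    }
    where
    closed : ∀ {x} α → SameBlock (p ⊗ p') x (ι α) → ∃[ u ] x ≡ ι u
    closed {x} α x∼α with origin x
    ... | left u  = u , refl
    ... | right u = ⊥-elim (ι≁ι' α u (sym x∼α))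

  ι'ᴱ : Embedding p' (p ⊗ p')
  ι'ᴱ = record
    { map           = ι'
    ; shift         = K ℕ.+_
    ; shift-<       = +-monoʳ-< K
    ; pos-map       = pos-ι'
    ; ncolor-map    = ncolor-ι'
    ; sameBlock-map = sameBlock-relabel {p'} {p ⊗ p'} {ι'} (ℕ.*-cancelˡ-≡ _ _ 2 ∘ ℕ.suc-injective) label-ι'
    ; block-closed  = closed
    }
    where
    closed : ∀ {x} β → SameBlock (p ⊗ p') x (ι' β) → ∃[ u ] x ≡ ι' u
    closed {x} β x∼β with origin x
    ... | left u  = ⊥-elim (ι≁ι' u β x∼β)
    ... | right u = u , refl

  module Lᴱ = EmbeddingProperties ιᴱ
  module Rᴱ = EmbeddingProperties ι'ᴱ

  sumOver-⊗ : ∀ {A : Set} {_∙_ : A → A → A} {ε : A} (isCM : IsCommutativeMonoid _≡_ _∙_ ε) →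
    let open FoldSum isCM in
    ∀ f → sumOver f (points (p ⊗ p')) ≡ sumOver (f ∘ ι) (points p) ∙ sumOver (f ∘ ι') (points p')
  sumOver-⊗ {_∙_ = _∙_} isCM f = begin
    sumOver f (points (p ⊗ p'))                                    ≡⟨ sumOver-↭ f points-⊗ ⟩
    sumOver f (List.map ι (points p) ++ List.map ι' (points p'))   ≡⟨ sumOver-++ f (List.map ι (points p)) _ ⟩
    sumOver f (List.map ι (points p)) ∙ sumOver f (List.map ι' (points p'))
      ≡⟨ cong₂ _∙_ (sumOver-map f ι (points p)) (sumOver-map f ι' (points p')) ⟩
    sumOver (f ∘ ι) (points p) ∙ sumOver (f ∘ ι') (points p')      ∎
    where
    open FoldSum isCM
    open ≡-Reasoning

  σ-⊗ : ∀ S → σ (p ⊗ p') S ≡ σ p (S ∘ ι) + σ p' (S ∘ ι')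
  σ-⊗ S = trans (sumOver-⊗ ℤ.+-0-isCommutativeMonoid (λ γ → if S γ then weight (p ⊗ p') γ else 0ℤ))
    (cong₂ _+_ (ℤΣ.sumOver-cong (λ α → cong (if S (ι α) then_else 0ℤ) (Lᴱ.weight-map α)) (points p))
               (ℤΣ.sumOver-cong (λ β → cong (if S (ι' β) then_else 0ℤ) (Rᴱ.weight-map β)) (points p')))

  card-⊗ : ∀ S → card (p ⊗ p') S ≡ card p (S ∘ ι) ℕ.+ card p' (S ∘ ι')
  card-⊗ S = begin
    card (p ⊗ p') S                                          ≡⟨ card≡sumOver (p ⊗ p') S ⟩
    ℕΣ.sumOver (indicator S) (points (p ⊗ p'))               ≡⟨ sumOver-⊗ ℕ.+-0-isCommutativeMonoid (indicator S) ⟩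
    ℕΣ.sumOver (indicator (S ∘ ι)) (points p) ℕ.+ ℕΣ.sumOver (indicator (S ∘ ι')) (points p')
      ≡⟨ cong₂ ℕ._+_ (card≡sumOver p (S ∘ ι)) (card≡sumOver p' (S ∘ ι')) ⟨
    card p (S ∘ ι) ℕ.+ card p' (S ∘ ι')                      ∎
    where open ≡-Reasoning

  Σ-⊗ : Σp (p ⊗ p') ≡ Σp p + Σp p'
  Σ-⊗ = σ-⊗ (λ _ → true)

  blockOf-ι-ι' : ∀ α β → blockOf (p ⊗ p') (ι α) (ι' β) ≡ false
  blockOf-ι-ι' α β = ≡ᵇ-false (ι≁ι' α β ∘ sym)

  blockOf-ι'-ι : ∀ β α → blockOf (p ⊗ p') (ι' β) (ι α) ≡ false
  blockOf-ι'-ι β α = ≡ᵇ-false (ι≁ι' α β)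

  card-block-ι : ∀ α → card (p ⊗ p') (blockOf (p ⊗ p') (ι α)) ≡ card p (blockOf p α)
  card-block-ι α = begin
    card (p ⊗ p') (blockOf (p ⊗ p') (ι α))
      ≡⟨ card-⊗ (blockOf (p ⊗ p') (ι α)) ⟩
    card p (blockOf (p ⊗ p') (ι α) ∘ ι) ℕ.+ card p' (blockOf (p ⊗ p') (ι α) ∘ ι')
      ≡⟨ cong₂ ℕ._+_ (card-cong p (Lᴱ.blockOf-map α)) (trans (card-cong p' (blockOf-ι-ι' α)) (card-empty p')) ⟩
    card p (blockOf p α) ℕ.+ 0
      ≡⟨ ℕ.+-identityʳ _ ⟩
    card p (blockOf p α) ∎
    where open ≡-Reasoning

  card-block-ι' : ∀ β → card (p ⊗ p') (blockOf (p ⊗ p') (ι' β)) ≡ card p' (blockOf p' β)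
  card-block-ι' β = begin
    card (p ⊗ p') (blockOf (p ⊗ p') (ι' β))
      ≡⟨ card-⊗ (blockOf (p ⊗ p') (ι' β)) ⟩
    card p (blockOf (p ⊗ p') (ι' β) ∘ ι) ℕ.+ card p' (blockOf (p ⊗ p') (ι' β) ∘ ι')
      ≡⟨ cong₂ ℕ._+_ (trans (card-cong p (blockOf-ι'-ι β)) (card-empty p)) (card-cong p' (Rᴱ.blockOf-map β)) ⟩
    card p' (blockOf p' β) ∎
    where open ≡-Reasoning

  σ-block-ι : ∀ α → σ (p ⊗ p') (blockOf (p ⊗ p') (ι α)) ≡ σ p (blockOf p α)
  σ-block-ι α = begin
    σ (p ⊗ p') (blockOf (p ⊗ p') (ι α))
      ≡⟨ σ-⊗ (blockOf (p ⊗ p') (ι α)) ⟩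
    σ p (blockOf (p ⊗ p') (ι α) ∘ ι) + σ p' (blockOf (p ⊗ p') (ι α) ∘ ι')
      ≡⟨ cong₂ _+_ (σ-cong p (Lᴱ.blockOf-map α)) (trans (σ-cong p' (blockOf-ι-ι' α)) (σ-const p' false)) ⟩
    σ p (blockOf p α) + 0ℤ
      ≡⟨ ℤ.+-identityʳ _ ⟩
    σ p (blockOf p α) ∎
    where open ≡-Reasoning

  σ-block-ι' : ∀ β → σ (p ⊗ p') (blockOf (p ⊗ p') (ι' β)) ≡ σ p' (blockOf p' β)
  σ-block-ι' β = begin
    σ (p ⊗ p') (blockOf (p ⊗ p') (ι' β))
      ≡⟨ σ-⊗ (blockOf (p ⊗ p') (ι' β)) ⟩
    σ p (blockOf (p ⊗ p') (ι' β) ∘ ι) + σ p' (blockOf (p ⊗ p') (ι' β) ∘ ι')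
      ≡⟨ cong₂ _+_ (trans (σ-cong p (blockOf-ι'-ι β)) (σ-const p false)) (σ-cong p' (Rᴱ.blockOf-map β)) ⟩
    0ℤ + σ p' (blockOf p' β)
      ≡⟨ ℤ.+-identityˡ _ ⟩
    σ p' (blockOf p' β) ∎
    where open ≡-Reasoning

  blockStatistic-⊗ : ∀ {A : Set} (stat : (q : Partition) → (Point q → Bool) → A) →
    (∀ α → stat (p ⊗ p') (blockOf (p ⊗ p') (ι α)) ≡ stat p (blockOf p α)) →
    (∀ β → stat (p ⊗ p') (blockOf (p ⊗ p') (ι' β)) ≡ stat p' (blockOf p' β)) →
    ∀ a → (∃[ x ] a ≡ stat (p ⊗ p') (blockOf (p ⊗ p') x)) ⇔
          ((∃[ α ] a ≡ stat p (blockOf p α)) ⊎ (∃[ β ] a ≡ stat p' (blockOf p' β)))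
  blockStatistic-⊗ stat stat-ι stat-ι' a = mk⇔ to from
    where
    to : (∃[ x ] a ≡ stat (p ⊗ p') (blockOf (p ⊗ p') x)) →
         (∃[ α ] a ≡ stat p (blockOf p α)) ⊎ (∃[ β ] a ≡ stat p' (blockOf p' β))
    to (x , a≡) with origin x
    ... | left α  = inj₁ (α , trans a≡ (stat-ι α))
    ... | right β = inj₂ (β , trans a≡ (stat-ι' β))
    from : (∃[ α ] a ≡ stat p (blockOf p α)) ⊎ (∃[ β ] a ≡ stat p' (blockOf p' β)) →
           ∃[ x ] a ≡ stat (p ⊗ p') (blockOf (p ⊗ p') x)
    from (inj₁ (α , a≡)) = ι α , trans a≡ (sym (stat-ι α))
    from (inj₂ (β , a≡)) = ι' β , trans a≡ (sym (stat-ι' β))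

  F-⊗ : ∀ n → F₁ (p ⊗ p') n ⇔ (F₁ p ∪₂ F₁ p') n
  F-⊗ = blockStatistic-⊗ card card-block-ι card-block-ι'

  V-⊗ : ∀ z → V₁ (p ⊗ p') z ⇔ (V₁ p ∪₂ V₁ p') z
  V-⊗ = blockStatistic-⊗ σ σ-block-ι σ-block-ι'

  ι-outside : ∀ α → Outside (pos (p ⊗ p') (ι α))
  ι-outside α = subst Outside (sym (pos-ι α)) (skipWindow-outside (pos p α))

  ι'-inside : ∀ β → Inside (pos (p ⊗ p') (ι' β))
  ι'-inside β = subst Inside (sym (pos-ι' β)) (m≤m+n K (pos p' β) , +-monoʳ-< K (pos-< p' β))

  inOpen-ι-ι' : ∀ a b c →
    inOpen (p ⊗ p') (ι a) (ι b) (ι' c) ≡ crossesWindow (pos (p ⊗ p') (ι a)) (pos (p ⊗ p') (ι b))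
  inOpen-ι-ι' a b c = trans (inOpen≡between (p ⊗ p') (ι a) (ι b) (ι' c))
    (between-outside-outside-inside (ι-outside a) (ι-outside b) (ι'-inside c))

  inOpen-ι'-ι : ∀ a b c →
    inOpen (p ⊗ p') (ι' a) (ι' b) (ι c) ≡ not (pos (p ⊗ p') (ι' a) <ᵇ pos (p ⊗ p') (ι' b))
  inOpen-ι'-ι a b c = trans (inOpen≡between (p ⊗ p') (ι' a) (ι' b) (ι c))
    (between-inside-inside-outside (ι'-inside a) (ι'-inside b) (ι-outside c))

  ι≢ι' : ∀ α β → ι α ≢ ι' β
  ι≢ι' α β = ι≁ι' α β ∘ cong (label (p ⊗ p'))

  δ-ι : ∀ {a b} → a ≢ b → δ (p ⊗ p') (ι a) (ι b) ≡
    δ p a b + (if crossesWindow (pos (p ⊗ p') (ι a)) (pos (p ⊗ p') (ι b)) then Σp p' else 0ℤ)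
  δ-ι {a} {b} a≢b = begin
    δ (p ⊗ p') (ι a) (ι b)                                   ≡⟨ δ-distinct (p ⊗ p') (a≢b ∘ Lᴱ.map-injective) ⟩
    σ (p ⊗ p') I                                             ≡⟨ σ-⊗ I ⟩
    σ p (I ∘ ι) + σ p' (I ∘ ι')                              ≡⟨ cong₂ _+_ (σ-cong p (Lᴱ.arc-map a b)) (σ-cong p' I∘ι') ⟩
    σ p (arc p a b) + σ p' (λ _ → C)                         ≡⟨ cong₂ _+_ (sym (δ-distinct p a≢b)) (σ-const p' C) ⟩
    δ p a b + (if C then Σp p' else 0ℤ)                      ∎
    where
    open ≡-Reasoning
    I : Point (p ⊗ p') → Bool
    I = arc (p ⊗ p') (ι a) (ι b)
    C : Bool
    C = crossesWindow (pos (p ⊗ p') (ι a)) (pos (p ⊗ p') (ι b))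
    I∘ι' : ∀ c → I (ι' c) ≡ C
    I∘ι' c = trans (arc≡inOpen (p ⊗ p') (ι≢ι' b c ∘ sym)) (inOpen-ι-ι' a b c)

  δ-ι' : ∀ {a b} → a ≢ b → δ (p ⊗ p') (ι' a) (ι' b) ≡
    δ p' a b + (if not (pos (p ⊗ p') (ι' a) <ᵇ pos (p ⊗ p') (ι' b)) then Σp p else 0ℤ)
  δ-ι' {a} {b} a≢b = begin
    δ (p ⊗ p') (ι' a) (ι' b)                                 ≡⟨ δ-distinct (p ⊗ p') (a≢b ∘ Rᴱ.map-injective) ⟩
    σ (p ⊗ p') I                                             ≡⟨ σ-⊗ I ⟩
    σ p (I ∘ ι) + σ p' (I ∘ ι')                              ≡⟨ cong₂ _+_ (σ-cong p I∘ι) (σ-cong p' (Rᴱ.arc-map a b)) ⟩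
    σ p (λ _ → C) + σ p' (arc p' a b)                        ≡⟨ cong₂ _+_ (σ-const p C) (sym (δ-distinct p' a≢b)) ⟩
    (if C then Σp p else 0ℤ) + δ p' a b                      ≡⟨ ℤ.+-comm (if C then Σp p else 0ℤ) (δ p' a b) ⟩
    δ p' a b + (if C then Σp p else 0ℤ)                      ∎
    where
    open ≡-Reasoning
    I : Point (p ⊗ p') → Bool
    I = arc (p ⊗ p') (ι' a) (ι' b)
    C : Bool
    C = not (pos (p ⊗ p') (ι' a) <ᵇ pos (p ⊗ p') (ι' b))
    I∘ι : ∀ c → I (ι c) ≡ C
    I∘ι c = trans (arc≡inOpen (p ⊗ p') (ι≢ι' c b)) (inOpen-ι'-ι a b c)

  g : ℤ
  g = gcd (Σp p) (Σp p')

  g∣Σp : g ∣ Σp p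
  g∣Σp = ∣ᵤ⇒∣ {g} (gcd[i,j]∣i (Σp p) (Σp p'))

  g∣Σp' : g ∣ Σp p'
  g∣Σp' = ∣ᵤ⇒∣ {g} (gcd[i,j]∣j (Σp p) (Σp p'))

  δ-ι∈ : ∀ {A A' : Pred ℤ 0ℓ} a b → a ≢ b → A (δ p a b) → ((A ∪₂ A') +ℤ* g) (δ (p ⊗ p') (ι a) (ι b))
  δ-ι∈ {A} {A'} a b a≢b Aδ = subst ((A ∪₂ A') +ℤ* g) (sym (δ-ι a≢b)) (+ℤ*-shift (inj₁ Aδ)
    (∣-select (crossesWindow (pos (p ⊗ p') (ι a)) (pos (p ⊗ p') (ι b))) g∣Σp'))

  δ-ι'∈ : ∀ {A A' : Pred ℤ 0ℓ} a b → a ≢ b → A' (δ p' a b) → ((A ∪₂ A') +ℤ* g) (δ (p ⊗ p') (ι' a) (ι' b))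
  δ-ι'∈ {A} {A'} a b a≢b A'δ = subst ((A ∪₂ A') +ℤ* g) (sym (δ-ι' a≢b)) (+ℤ*-shift (inj₂ A'δ)
    (∣-select (not (pos (p ⊗ p') (ι' a) <ᵇ pos (p ⊗ p') (ι' b))) g∣Σp))

  consecutiveDistances-⊗ : ∀ (R : ℤ → Set) z → ConsecutiveDistances (p ⊗ p') R z →
    ((ConsecutiveDistances p R ∪₂ ConsecutiveDistances p' R) +ℤ* g) z
  consecutiveDistances-⊗ R _ (x₁ , x₂ , c@(x₁∼x₂ , x₁≢x₂ , _) , r , refl) with origin x₁ | origin x₂
  ... | left a  | left b  = δ-ι∈ a b (x₁≢x₂ ∘ cong ι)
    (a , b , Lᴱ.consecutive-map c , subst R (cong₂ _+_ (Lᴱ.weight-map a) (Lᴱ.weight-map b)) r , refl)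
  ... | left a  | right b = ⊥-elim (ι≁ι' a b x₁∼x₂)
  ... | right a | left b  = ⊥-elim (ι≁ι' b a (sym x₁∼x₂))
  ... | right a | right b = δ-ι'∈ a b (x₁≢x₂ ∘ cong ι')
    (a , b , Rᴱ.consecutive-map c , subst R (cong₂ _+_ (Rᴱ.weight-map a) (Rᴱ.weight-map b)) r , refl)

  ¬cross-ι-ι' : ∀ {α β} → ¬ Cross (p ⊗ p') (ι α) (ι' β)
  ¬cross-ι-ι' {α} {β} (_ , a , b , a' , b' , a∼ , b∼ , a'∼ , b'∼ , a≢b , _ , a'∈]a,b[ , b'∈]b,a[)
    with Embedding.block-closed ιᴱ {a} α a∼ | Embedding.block-closed ιᴱ {b} α b∼
       | Embedding.block-closed ι'ᴱ {a'} β a'∼ | Embedding.block-closed ι'ᴱ {b'} β b'∼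
  ... | u , refl | v , refl | u' , refl | v' , refl = crossesWindow-asym (a≢b ∘ pos-injective (p ⊗ p'))
    (trans (sym (inOpen-ι-ι' u v u')) a'∈]a,b[) (trans (sym (inOpen-ι-ι' v u v')) b'∈]b,a[)

  ¬cross-ι'-ι : ∀ {β α} → ¬ Cross (p ⊗ p') (ι' β) (ι α)
  ¬cross-ι'-ι {β} {α} (_ , a , b , a' , b' , a∼ , b∼ , a'∼ , b'∼ , a≢b , _ , a'∈]a,b[ , b'∈]b,a[)
    with Embedding.block-closed ι'ᴱ {a} β a∼ | Embedding.block-closed ι'ᴱ {b} β b∼
       | Embedding.block-closed ιᴱ {a'} α a'∼ | Embedding.block-closed ιᴱ {b'} α b'∼
  ... | u , refl | v , refl | u' , refl | v' , refl = a≢b (pos-injective (p ⊗ p') (ℕ.≤-antisym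
    (not-<ᵇ⇒≥ (trans (sym (inOpen-ι'-ι v u v')) b'∈]b,a[)) (not-<ᵇ⇒≥ (trans (sym (inOpen-ι'-ι u v u')) a'∈]a,b[))))

  X-⊗ : ∀ z → X₁ (p ⊗ p') z → ((X₁ p ∪₂ X₁ p') +ℤ* g) z
  X-⊗ _ (x₁ , x₂ , cross@(x₁≁x₂ , _) , refl) with origin x₁ | origin x₂
  ... | left a  | left b  = δ-ι∈ a b (λ { refl → x₁≁x₂ refl }) (a , b , Lᴱ.cross-map cross , refl)
  ... | left a  | right b = ⊥-elim (¬cross-ι-ι' {a} {b} cross)
  ... | right a | left b  = ⊥-elim (¬cross-ι'-ι {a} {b} cross)
  ... | right a | right b = δ-ι'∈ a b (λ { refl → x₁≁x₂ refl }) (a , b , Rᴱ.cross-map cross , refl)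

lemma6p5 : (p p' : Partition) →
    ((n : ℕ) → F₁ (p ⊗ p') n ⇔ (F₁ p ∪₂ F₁ p') n) ×
    ((z : ℤ) → V₁ (p ⊗ p') z ⇔ (V₁ p ∪₂ V₁ p') z) ×
    (Σp (p ⊗ p') ≡ Σp p + Σp p') ×
    ((z : ℤ) → L₁ (p ⊗ p') z → ((L₁ p ∪₂ L₁ p') +ℤ* gcd (Σp p) (Σp p')) z) ×
    ((z : ℤ) → K₁ (p ⊗ p') z → ((K₁ p ∪₂ K₁ p') +ℤ* gcd (Σp p) (Σp p')) z) ×
    ((z : ℤ) → X₁ (p ⊗ p') z → ((X₁ p ∪₂ X₁ p') +ℤ* gcd (Σp p) (Σp p')) z)
lemma6p5 p p' =
  F-⊗ , V-⊗ , Σ-⊗ , consecutiveDistances-⊗ (_≢ 0ℤ) , consecutiveDistances-⊗ (_≡ 0ℤ) , X-⊗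
  where open Tensor p p'
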